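{- Let $G$ be a finite simple graph with vertex set $[n]$, and let $\alpha_G$ denote the average, over all $2^n$ bicolorings $c$ of $G$, of the number of successful pressing sequences of $(G,c)$ of length $n$. Then $\alpha_G=\dfrac{n!}{2^n}$.
   Context: A bicoloring of $G$ is a map $c:V(G)\to\{\text{black},\text{white}\}$. Pressing a black vertex $v$ complements the induced subgraph on the closed neighborhood $N^\ast(v)=N(v)\cup\{v\}$ and flips the color of each vertex of $N^\ast(v)$, leaving everything else unchanged. A pressing sequence is a sequence of vertices each black at the moment it is pressed (after pressing the preceding ones in order); it is successful if the final graph has no edges and all vertices white. A successful pressing sequence of length $n$ consists of all $n$ vertices, each exactly once. -}

module Defs where

open import Data.Bool using (Bool; true; false; not; _∧_; _∨_; if_then_else_)
open import Data.Nat using (ℕ; zero; suc; _+_)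
open import Data.Fin using (Fin; _≟_) renaming (zero to fzero; suc to fsuc)
open import Data.List using (List; []; _∷_; [_]; map; concatMap; allFin)
open import Data.Nat.ListAction using (sum)
open import Data.Bool.ListAction using (all)
open import Data.Product using (_×_; _,_)
open import Relation.Nullary.Decidable using (does)
open import Relation.Binary.PropositionalEquality using (_≡_)

Graph : ℕ → Set
Graph n = Fin n → Fin n → Bool

IsSimple : ∀ {n} → Graph n → Set
IsSimple {n} G = (∀ (x y : Fin n) → G x y ≡ G y x) × (∀ (x : Fin n) → G x x ≡ false)

-- A bicoloring: true = black, false = white.
Bicoloring : ℕ → Set
Bicoloring n = Fin n → Bool

inClosedNbhd : ∀ {n} → Graph n → Fin n → Fin n → Bool
inClosedNbhd G v x = does (x ≟ v) ∨ G v x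

pressGraph : ∀ {n} → Graph n → Fin n → Graph n
pressGraph G v x y =
  if does (x ≟ y) then G x y
  else (if inClosedNbhd G v x ∧ inClosedNbhd G v y then not (G x y) else G x y)

pressColor : ∀ {n} → Graph n → Bicoloring n → Fin n → Bicoloring n
pressColor G c v x = if inClosedNbhd G v x then not (c x) else c x

emptyAndWhite : ∀ {n} → Graph n → Bicoloring n → Bool
emptyAndWhite {n} G c =
  all (λ x → not (c x) ∧ all (λ y → not (G x y)) (allFin n)) (allFin n)

successful : ∀ {n} → Graph n → Bicoloring n → List (Fin n) → Bool
successful G c [] = emptyAndWhite G c
successful G c (v ∷ vs) = c v ∧ successful (pressGraph G v) (pressColor G c v) vs

sequences : ∀ {n} → ℕ → List (List (Fin n))
sequences zero = [ [] ]
sequences {n} (suc k) = concatMap (λ v → map (v ∷_) (sequences k)) (allFin n)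

extend : ∀ {n} → Bool → Bicoloring n → Bicoloring (suc n)
extend b c fzero = b
extend b c (fsuc x) = c x

bicolorings : ∀ n → List (Bicoloring n)
bicolorings zero = [ (λ ()) ]
bicolorings (suc n) = concatMap (λ c → extend false c ∷ extend true c ∷ []) (bicolorings n)

numSuccessful : ∀ {n} → Graph n → Bicoloring n → ℕ
numSuccessful {n} G c =
  sum (map (λ s → if successful G c s then 1 else 0) (sequences {n} n))

-- sum over all 2^n bicolorings (= 2^n · α_G)
totalSuccessful : ∀ {n} → Graph n → ℕ
totalSuccessful {n} G = sum (map (numSuccessful G) (bicolorings n))

module Submission where

open import Defs
open import Data.Nat using (ℕ; _!)
open import Relation.Binary.PropositionalEquality using (_≡_)

-- Call a vertex set S (a predicate on Fin n) isolated in G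
-- if no vertex of S has a neighbour, and let
--   weight G S k = Σ over colorings c that are white on S of the number
--                  of successful pressing sequences of length k of (G , c).
-- Main claim: if G is simple, S is isolated in G and k vertices lie outside
-- S, then weight G S k = k!.  The theorem is the case S = ∅, k = n.
--   * k = 0: S is everything, G has no edges, and only the all-white
--     coloring is counted, with its single (empty) sequence.
--   * k + 1: split the sequences by their first vertex v.  For v ∈ S the
--     term vanishes (v is white).  For v ∉ S the closed neighbourhood N*(v)
--     misses S, so the translation c ↦ c ⊕ N*(v) of the coloring space maps
--     "white on S, black at v" onto "white on S ∪ {v}", turning the term into
--     weight (pressGraph G v) (S ∪ {v}) k = k! by induction.  Summing over
--     the k + 1 vertices outside S gives (k + 1)!.

open import Function using (_∘_)
open import Data.Bool using (Bool; true; false; not; _∧_; _∨_; if_then_else_)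
open import Data.Bool.Properties using (∧-conicalˡ; ∧-conicalʳ; ∧-assoc; ∧-comm; ∧-zeroʳ; ∧-identityʳ; not-involutive)
open import Data.Nat using (zero; suc; _+_; _*_)
open import Data.Nat.Properties using (+-assoc; +-comm; +-identityʳ; +-suc; *-identityˡ; suc-injective; +-*-semiring)
open import Data.Fin using (Fin; _≟_) renaming (zero to fzero; suc to fsuc)
open import Data.List using (List; []; _∷_; _++_; map; concatMap; allFin; tabulate)
open import Data.Bool.ListAction using (and; all)
open import Data.List.Properties using (map-++; map-cong; map-∘)
open import Data.Nat.ListAction using (sum)
open import Data.Nat.ListAction.Properties using (sum-++)
open import Data.Product using (_,_)
open import Data.Sum using (_⊎_; inj₁; inj₂)
open import Relation.Nullary.Decidable using (does; yes; no; dec-true; dec-false)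
open import Relation.Binary.PropositionalEquality
  using (refl; sym; trans; cong; cong₂; module ≡-Reasoning)
open import Algebra.Properties.Semiring.Sum +-*-semiring
  using (sum-syntax; sum-cong-≗; sum-replicate-zero; *-distribʳ-sum)
  renaming (sum to ∑)

open ≡-Reasoning

infixr 5 [_]·_
[_]·_ : Bool → ℕ → ℕ
[ b ]· x = if b then x else 0

select-∧ : ∀ a b x → ([ a ]· [ b ]· x) ≡ [ a ∧ b ]· x
select-∧ true  b x = refl
select-∧ false b x = refl

[]·-∑ : ∀ n b (f : Fin n → ℕ) → [ b ]· ∑[ v < n ] f v ≡ ∑[ v < n ] ([ b ]· f v)
[]·-∑ n true  f = refl
[]·-∑ n false f = sym (sum-replicate-zero n)

∑-select : ∀ n (P : Fin n → Bool) a →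
  ∑[ v < n ] ([ P v ]· a) ≡ (∑[ v < n ] ([ P v ]· 1)) * a
∑-select n P a = begin
  ∑[ v < n ] ([ P v ]· a)        ≡⟨ sum-cong-≗ (λ v → select-1 (P v)) ⟩
  ∑[ v < n ] (([ P v ]· 1) * a)  ≡⟨ sym (*-distribʳ-sum a (λ v → [ P v ]· 1)) ⟩
  (∑[ v < n ] ([ P v ]· 1)) * a  ∎
  where
    select-1 : ∀ b → [ b ]· a ≡ ([ b ]· 1) * a
    select-1 true  = sym (*-identityˡ a)
    select-1 false = refl

sum-concatMap : ∀ {A B : Set} (f : B → ℕ) (h : A → List B) (l : List A) →
  sum (map f (concatMap h l)) ≡ sum (map (λ x → sum (map f (h x))) l)
sum-concatMap f h []      = refl
sum-concatMap f h (x ∷ l) = begin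
  sum (map f (h x ++ concatMap h l))
    ≡⟨ cong sum (map-++ f (h x) (concatMap h l)) ⟩
  sum (map f (h x) ++ map f (concatMap h l))
    ≡⟨ sum-++ (map f (h x)) _ ⟩
  sum (map f (h x)) + sum (map f (concatMap h l))
    ≡⟨ cong (sum (map f (h x)) +_) (sum-concatMap f h l) ⟩
  sum (map f (h x)) + sum (map (λ y → sum (map f (h y))) l) ∎

sum-tabulate : ∀ {A : Set} n (f : A → ℕ) (g : Fin n → A) →
  sum (map f (tabulate g)) ≡ ∑[ v < n ] f (g v)
sum-tabulate zero    f g = refl
sum-tabulate (suc n) f g = cong (f (g fzero) +_) (sum-tabulate n f (g ∘ fsuc))

all-true : ∀ {A : Set} (p : A → Bool) → (∀ x → p x ≡ true) → ∀ l → and (map p l) ≡ true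
all-true p h []      = refl
all-true p h (x ∷ l) rewrite h x = all-true p h l

-- Pointwise equality of colorings; without function extensionality the
-- functions of colorings we sum must respect it.
infix 4 _≐_
_≐_ : ∀ {n} → Bicoloring n → Bicoloring n → Set
c ≐ d = ∀ x → c x ≡ d x

Respects≐ : ∀ {n} → (Bicoloring n → ℕ) → Set
Respects≐ {n} f = ∀ {c d : Bicoloring n} → c ≐ d → f c ≡ f d

VertexSet : ℕ → Set
VertexSet n = Fin n → Bool

-- Pressing v translates the coloring by the closed neighbourhood of v:
-- pressColor G c v is definitionally c ⊕ inClosedNbhd G v.
infixl 6 _⊕_
_⊕_ : ∀ {n} → Bicoloring n → VertexSet n → Bicoloring n
(c ⊕ m) x = if m x then not (c x) else c x

⊕-cong : ∀ {n} {c d : Bicoloring n} (m : VertexSet n) → c ≐ d → c ⊕ m ≐ d ⊕ m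
⊕-cong m c≐d x = cong (λ b → if m x then not b else b) (c≐d x)

⊕-involutive : ∀ {n} (c : Bicoloring n) (m : VertexSet n) → (c ⊕ m) ⊕ m ≐ c
⊕-involutive c m x with m x
... | true  = not-involutive (c x)
... | false = refl

⊕-inside : ∀ {n} (c : Bicoloring n) (m : VertexSet n) x → m x ≡ true → (c ⊕ m) x ≡ not (c x)
⊕-inside c m x mx rewrite mx = refl

⊕-outside : ∀ {n} (c : Bicoloring n) (m : VertexSet n) x → m x ≡ false → (c ⊕ m) x ≡ c x
⊕-outside c m x mx rewrite mx = refl

sumColorings : ∀ n → (Bicoloring n → ℕ) → ℕ
sumColorings zero    f = f (λ ())
sumColorings (suc n) f = sumColorings n (λ c → f (extend false c) + f (extend true c))

sum-bicolorings : ∀ n (f : Bicoloring n → ℕ) → sum (map f (bicolorings n)) ≡ sumColorings n f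
sum-bicolorings zero    f = +-identityʳ (f (λ ()))
sum-bicolorings (suc n) f = begin
  sum (map f (concatMap (λ c → extend false c ∷ extend true c ∷ []) (bicolorings n)))
    ≡⟨ sum-concatMap f (λ c → extend false c ∷ extend true c ∷ []) (bicolorings n) ⟩
  sum (map (λ c → f (extend false c) + (f (extend true c) + 0)) (bicolorings n))
    ≡⟨ cong sum (map-cong (λ c → cong (f (extend false c) +_) (+-identityʳ _)) (bicolorings n)) ⟩
  sum (map (λ c → f (extend false c) + f (extend true c)) (bicolorings n))
    ≡⟨ sum-bicolorings n _ ⟩
  sumColorings (suc n) f ∎

sumColorings-cong : ∀ n {f g : Bicoloring n → ℕ} → (∀ c → f c ≡ g c) →
  sumColorings n f ≡ sumColorings n g
sumColorings-cong zero    f≗g = f≗g _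
sumColorings-cong (suc n) f≗g = sumColorings-cong n (λ c → cong₂ _+_ (f≗g _) (f≗g _))

sumColorings-zero : ∀ n → sumColorings n (λ _ → 0) ≡ 0
sumColorings-zero zero    = refl
sumColorings-zero (suc n) = sumColorings-zero n

sumColorings-+ : ∀ n (f g : Bicoloring n → ℕ) →
  sumColorings n (λ c → f c + g c) ≡ sumColorings n f + sumColorings n g
sumColorings-+ zero    f g = refl
sumColorings-+ (suc n) f g =
  trans (sumColorings-cong n (λ c → interchange (f (extend false c)) (g (extend false c))
                                                (f (extend true c)) (g (extend true c))))
        (sumColorings-+ n _ _)
  where
    interchange : ∀ a b c d → (a + b) + (c + d) ≡ (a + c) + (b + d)
    interchange a b c d = begin
      (a + b) + (c + d)  ≡⟨ +-assoc a b (c + d) ⟩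
      a + (b + (c + d))  ≡⟨ cong (a +_) (sym (+-assoc b c d)) ⟩
      a + ((b + c) + d)  ≡⟨ cong (λ z → a + (z + d)) (+-comm b c) ⟩
      a + ((c + b) + d)  ≡⟨ cong (a +_) (+-assoc c b d) ⟩
      a + (c + (b + d))  ≡⟨ sym (+-assoc a c (b + d)) ⟩
      (a + c) + (b + d)  ∎

sumColorings-∑ : ∀ n k (F : Bicoloring n → Fin k → ℕ) →
  sumColorings n (λ c → ∑[ v < k ] F c v) ≡ ∑[ v < k ] sumColorings n (λ c → F c v)
sumColorings-∑ n zero    F = sumColorings-zero n
sumColorings-∑ n (suc k) F =
  trans (sumColorings-+ n (λ c → F c fzero) (λ c → ∑[ v < k ] F c (fsuc v)))
        (cong (sumColorings n (λ c → F c fzero) +_) (sumColorings-∑ n k (λ c → F c ∘ fsuc)))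

-- Translation invariance: c ↦ c ⊕ m is a bijection of the coloring space.
sumColorings-translate : ∀ n (g : Bicoloring n → ℕ) (m : VertexSet n) → Respects≐ g →
  sumColorings n (λ c → g (c ⊕ m)) ≡ sumColorings n g
sumColorings-translate zero    g m resp = resp (λ ())
sumColorings-translate (suc n) g m resp = begin
  sumColorings n (λ c → g (extend false c ⊕ m) + g (extend true c ⊕ m))
    ≡⟨ sumColorings-cong n (λ c → cong₂ _+_ (resp (extend-⊕ false c)) (resp (extend-⊕ true c))) ⟩
  sumColorings n (λ c → g (extend (flip false) (c ⊕ tail)) + g (extend (flip true) (c ⊕ tail)))
    ≡⟨ sumColorings-cong n (λ c → pair-swap (m fzero) (c ⊕ tail)) ⟩
  sumColorings n (λ c → pairs (c ⊕ tail))
    ≡⟨ sumColorings-translate n pairs tail pairs-resp ⟩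
  sumColorings (suc n) g ∎
  where
    tail : VertexSet n
    tail = m ∘ fsuc
    flip : Bool → Bool
    flip b = if m fzero then not b else b
    extend-⊕ : ∀ b c → extend b c ⊕ m ≐ extend (flip b) (c ⊕ tail)
    extend-⊕ b c fzero    = refl
    extend-⊕ b c (fsuc x) = refl
    pairs : Bicoloring n → ℕ
    pairs c = g (extend false c) + g (extend true c)
    pairs-resp : Respects≐ pairs
    pairs-resp c≐d = cong₂ _+_ (resp (extend-cong false c≐d)) (resp (extend-cong true c≐d))
      where
        extend-cong : ∀ b {c d : Bicoloring n} → c ≐ d → extend b c ≐ extend b d
        extend-cong b c≐d fzero    = refl
        extend-cong b c≐d (fsuc x) = c≐d x
    pair-swap : ∀ s c → g (extend (if s then not false else false) c)
                        + g (extend (if s then not true else true) c) ≡ pairs c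
    pair-swap false c = refl
    pair-swap true  c = +-comm (g (extend true c)) (g (extend false c))

insert : ∀ {n} → Fin n → VertexSet n → VertexSet n
insert v S x = does (x ≟ v) ∨ S x

whiteOn : ∀ {n} → VertexSet n → Bicoloring n → Bool
whiteOn {zero}  S c = true
whiteOn {suc n} S c = not (S fzero ∧ c fzero) ∧ whiteOn (S ∘ fsuc) (c ∘ fsuc)

whiteOn-local : ∀ {n} (S : VertexSet n) {c d : Bicoloring n} →
  (∀ x → S x ≡ true → c x ≡ d x) → whiteOn S c ≡ whiteOn S d
whiteOn-local {zero}  S agree = refl
whiteOn-local {suc n} S agree =
  cong₂ _∧_ (cong not (guarded (S fzero) (agree fzero)))
            (whiteOn-local (S ∘ fsuc) (agree ∘ fsuc))
  where
    guarded : ∀ s {a b} → (s ≡ true → a ≡ b) → s ∧ a ≡ s ∧ b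
    guarded true  a≡b = a≡b refl
    guarded false a≡b = refl

whiteOn-sound : ∀ {n} (S : VertexSet n) c → whiteOn S c ≡ true → ∀ x → S x ≡ true → c x ≡ false
whiteOn-sound {suc n} S c w fzero    Sx = first-white (S fzero) (c fzero) (∧-conicalˡ _ _ w) Sx
  where
    first-white : ∀ s b → not (s ∧ b) ≡ true → s ≡ true → b ≡ false
    first-white true  true  () _
    first-white true  false _  _  = refl
    first-white false b     _  ()
whiteOn-sound {suc n} S c w (fsuc x) Sx = whiteOn-sound (S ∘ fsuc) (c ∘ fsuc) (∧-conicalʳ _ _ w) x Sx

whiteOn-insert : ∀ {n} (S : VertexSet n) v (c : Bicoloring n) →
  whiteOn (insert v S) c ≡ whiteOn S c ∧ not (c v)
whiteOn-insert {suc n} S fzero c with c fzero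
... | true  = sym (∧-zeroʳ _)
... | false = sym (trans (∧-identityʳ _) (cong (λ b → not b ∧ rest) (∧-zeroʳ (S fzero))))
  where
    rest : Bool
    rest = whiteOn (S ∘ fsuc) (c ∘ fsuc)
whiteOn-insert {suc n} S (fsuc v) c =
  trans (cong (not (S fzero ∧ c fzero) ∧_) (whiteOn-insert (S ∘ fsuc) v (c ∘ fsuc)))
        (sym (∧-assoc (not (S fzero ∧ c fzero)) _ _))

whiteOn-∅ : ∀ {n} (c : Bicoloring n) → whiteOn (λ _ → false) c ≡ true
whiteOn-∅ {zero}  c = refl
whiteOn-∅ {suc n} c = whiteOn-∅ (c ∘ fsuc)

sumColorings-allWhite : ∀ n (S : VertexSet n) → (∀ x → S x ≡ true) →
  sumColorings n (λ c → [ whiteOn S c ]· 1) ≡ 1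
sumColorings-allWhite zero    S full = refl
sumColorings-allWhite (suc n) S full =
  trans (sumColorings-cong n (λ c → first-black-excluded (S fzero) (full fzero) _))
        (sumColorings-allWhite n (S ∘ fsuc) (full ∘ fsuc))
  where
    first-black-excluded : ∀ s → s ≡ true → ∀ w →
      ([ not (s ∧ false) ∧ w ]· 1) + ([ not (s ∧ true) ∧ w ]· 1) ≡ [ w ]· 1
    first-black-excluded true refl w = +-identityʳ _

insert-cases : ∀ {n} (S : VertexSet n) v x → insert v S x ≡ true → x ≡ v ⊎ S x ≡ true
insert-cases S v x x∈ with x ≟ v
... | yes x≡v = inj₁ x≡v
... | no  _   = inj₂ x∈

outside : ∀ {n} → VertexSet n → ℕ
outside {n} S = ∑[ x < n ] ([ not (S x) ]· 1)

outside-∅ : ∀ n → outside {n} (λ _ → false) ≡ n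
outside-∅ zero    = refl
outside-∅ (suc n) = cong suc (outside-∅ n)

outside-insert : ∀ {n} (S : VertexSet n) v → S v ≡ false → outside S ≡ suc (outside (insert v S))
outside-insert {suc n} S fzero    Sv rewrite Sv = refl
outside-insert {suc n} S (fsuc v) Sv =
  trans (cong (([ not (S fzero) ]· 1) +_) (outside-insert (S ∘ fsuc) v Sv))
        (+-suc ([ not (S fzero) ]· 1) _)

outside-zero : ∀ {n} (S : VertexSet n) → outside S ≡ 0 → ∀ x → S x ≡ true
outside-zero {suc n} S none x with S fzero in S0
outside-zero {suc n} S none fzero    | true = S0
outside-zero {suc n} S none (fsuc x) | true = outside-zero (S ∘ fsuc) none x

does-≟-sym : ∀ {n} (x y : Fin n) → does (x ≟ y) ≡ does (y ≟ x)
does-≟-sym x y with x ≟ y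
... | yes refl = sym (dec-true (x ≟ x) refl)
... | no  x≢y  = sym (dec-false (y ≟ x) (x≢y ∘ sym))

inClosedNbhd-self : ∀ {n} (G : Graph n) v → inClosedNbhd G v v ≡ true
inClosedNbhd-self G v rewrite dec-true (v ≟ v) refl = refl

Isolated : ∀ {n} → VertexSet n → Graph n → Set
Isolated {n} S G = ∀ x → S x ≡ true → ∀ (y : Fin n) → G x y ≡ false

nbhd-misses-isolated : ∀ {n} (G : Graph n) (S : VertexSet n) v → IsSimple G → Isolated S G →
  S v ≡ false → ∀ x → S x ≡ true → inClosedNbhd G v x ≡ false
nbhd-misses-isolated G S v (symmetric , _) iso Sv x Sx with x ≟ v
... | yes refl with () ← trans (sym Sx) Sv
... | no  _ rewrite symmetric v x = iso x Sx v

pressGraph-away : ∀ {n} (G : Graph n) v x y → inClosedNbhd G v x ≡ false →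
  pressGraph G v x y ≡ G x y
pressGraph-away G v x y away with does (x ≟ y)
... | true  = refl
... | false rewrite away = refl

pressGraph-centre : ∀ {n} (G : Graph n) v y → IsSimple G → pressGraph G v v y ≡ false
pressGraph-centre G v y (symmetric , loopless) with v ≟ y
... | yes refl = loopless v
... | no  v≢y
  rewrite inClosedNbhd-self G v | dec-false (y ≟ v) (v≢y ∘ sym) with G v y
...   | true  = refl
...   | false = refl

pressGraph-simple : ∀ {n} (G : Graph n) v → IsSimple G → IsSimple (pressGraph G v)
pressGraph-simple G v (symmetric , loopless) = pressed-symmetric , pressed-loopless
  where
    pressed-symmetric : ∀ x y → pressGraph G v x y ≡ pressGraph G v y x
    pressed-symmetric x y
      rewrite does-≟-sym x y | symmetric x y | ∧-comm (inClosedNbhd G v x) (inClosedNbhd G v y) = refl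
    pressed-loopless : ∀ x → pressGraph G v x x ≡ false
    pressed-loopless x rewrite dec-true (x ≟ x) refl = loopless x

pressGraph-isolated : ∀ {n} (G : Graph n) (S : VertexSet n) v → IsSimple G → Isolated S G →
  S v ≡ false → Isolated (insert v S) (pressGraph G v)
pressGraph-isolated G S v simple iso Sv x x∈ y with insert-cases S v x x∈
... | inj₁ refl = pressGraph-centre G v y simple
... | inj₂ Sx   =
  trans (pressGraph-away G v x y (nbhd-misses-isolated G S v simple iso Sv x Sx)) (iso x Sx y)

successes : ∀ {n} → Graph n → ℕ → Bicoloring n → ℕ
successes {n} G k c = sum (map (λ s → [ successful G c s ]· 1) (sequences {n} k))

successful-resp : ∀ {n} (G : Graph n) {c d : Bicoloring n} → c ≐ d →
  ∀ s → successful G c s ≡ successful G d s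
successful-resp {n} G c≐d [] =
  cong and (map-cong (λ x → cong (λ b → not b ∧ all (λ y → not (G x y)) (allFin n)) (c≐d x)) (allFin n))
successful-resp G c≐d (v ∷ vs) =
  cong₂ _∧_ (c≐d v) (successful-resp (pressGraph G v) (⊕-cong (inClosedNbhd G v) c≐d) vs)

successes-resp : ∀ {n} (G : Graph n) k → Respects≐ (successes G k)
successes-resp G k c≐d =
  cong sum (map-cong (λ s → cong ([_]· 1) (successful-resp G c≐d s)) (sequences k))

successes-done : ∀ {n} (G : Graph n) c → (∀ x y → G x y ≡ false) → (∀ x → c x ≡ false) →
  successes G 0 c ≡ 1
successes-done {n} G c edgeless white = cong (λ b → ([ b ]· 1) + 0) (all-true _ finished (allFin n))
  where
    finished : ∀ x → (not (c x) ∧ all (λ y → not (G x y)) (allFin n)) ≡ true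
    finished x rewrite white x = all-true _ (λ y → cong not (edgeless x y)) (allFin n)

successes-suc : ∀ {n} (G : Graph n) k c → successes G (suc k) c ≡
  ∑[ v < n ] ([ c v ]· successes (pressGraph G v) k (c ⊕ inClosedNbhd G v))
successes-suc {n} G k c = begin
  sum (map count (concatMap (λ v → map (v ∷_) (sequences k)) (allFin n)))
    ≡⟨ sum-concatMap count (λ v → map (v ∷_) (sequences k)) (allFin n) ⟩
  sum (map (λ v → sum (map count (map (v ∷_) (sequences k)))) (allFin n))
    ≡⟨ sum-tabulate n (λ v → sum (map count (map (v ∷_) (sequences k)))) (λ v → v) ⟩
  ∑[ v < n ] sum (map count (map (v ∷_) (sequences k)))
    ≡⟨ sum-cong-≗ (λ v → trans (cong sum (sym (map-∘ (sequences k))))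
                                (guard (c v) (successful (pressGraph G v) (c ⊕ inClosedNbhd G v))
                                       (sequences k))) ⟩
  ∑[ v < n ] ([ c v ]· successes (pressGraph G v) k (c ⊕ inClosedNbhd G v)) ∎
  where
    count : List (Fin n) → ℕ
    count s = [ successful G c s ]· 1
    guard : ∀ b (P : List (Fin n) → Bool) l →
      sum (map (λ s → [ b ∧ P s ]· 1) l) ≡ [ b ]· sum (map (λ s → [ P s ]· 1) l)
    guard true  P l       = refl
    guard false P []      = refl
    guard false P (_ ∷ l) = guard false P l

weight : ∀ {n} → Graph n → VertexSet n → ℕ → ℕ
weight {n} G S k = sumColorings n (λ c → [ whiteOn S c ]· successes G k c)

-- The sequences starting with v contribute nothing if v ∈ S (v is white),
-- and otherwise, after translating colorings by N*(v), exactly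
-- weight (pressGraph G v) (S ∪ {v}) k.
weight-first-vertex : ∀ {n} (G : Graph n) S k v → IsSimple G → Isolated S G →
  sumColorings n (λ c → [ whiteOn S c ]· [ c v ]· successes (pressGraph G v) k (c ⊕ inClosedNbhd G v))
    ≡ [ not (S v) ]· weight (pressGraph G v) (insert v S) k
weight-first-vertex {n} G S k v simple iso with S v in Sv
... | true  = trans (sumColorings-cong n white-at-v) (sumColorings-zero n)
  where
    white-at-v : ∀ c → ([ whiteOn S c ]· [ c v ]· successes (pressGraph G v) k (c ⊕ inClosedNbhd G v)) ≡ 0
    white-at-v c with whiteOn S c in w
    ... | false = refl
    ... | true rewrite whiteOn-sound S c w v Sv = refl
... | false = begin
  sumColorings n g                  ≡⟨ sym (sumColorings-translate n g N g-resp) ⟩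
  sumColorings n (λ c → g (c ⊕ N))  ≡⟨ sumColorings-cong n translated ⟩
  weight G′ (insert v S) k          ∎
  where
    G′ : Graph n
    G′ = pressGraph G v
    N : VertexSet n
    N = inClosedNbhd G v
    g : Bicoloring n → ℕ
    g c = [ whiteOn S c ]· [ c v ]· successes G′ k (c ⊕ N)
    g-resp : Respects≐ g
    g-resp c≐d = cong₂ [_]·_ (whiteOn-local S (λ x _ → c≐d x))
                             (cong₂ [_]·_ (c≐d v) (successes-resp G′ k (⊕-cong N c≐d)))
    translated : ∀ c → g (c ⊕ N) ≡ [ whiteOn (insert v S) c ]· successes G′ k c
    translated c = begin
      [ whiteOn S (c ⊕ N) ]· [ (c ⊕ N) v ]· successes G′ k (c ⊕ N ⊕ N)
        ≡⟨ cong₂ [_]·_ (whiteOn-local S (λ x Sx → ⊕-outside c N x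
                                          (nbhd-misses-isolated G S v simple iso Sv x Sx)))
                       (cong₂ [_]·_ (⊕-inside c N v (inClosedNbhd-self G v))
                                    (successes-resp G′ k (⊕-involutive c N))) ⟩
      [ whiteOn S c ]· [ not (c v) ]· successes G′ k c
        ≡⟨ select-∧ (whiteOn S c) (not (c v)) _ ⟩
      [ whiteOn S c ∧ not (c v) ]· successes G′ k c
        ≡⟨ cong ([_]· successes G′ k c) (sym (whiteOn-insert S v c)) ⟩
      [ whiteOn (insert v S) c ]· successes G′ k c ∎

weight-suc : ∀ {n} (G : Graph n) S k → IsSimple G → Isolated S G →
  weight G S (suc k) ≡ ∑[ v < n ] ([ not (S v) ]· weight (pressGraph G v) (insert v S) k)
weight-suc {n} G S k simple iso = begin
  sumColorings n (λ c → [ whiteOn S c ]· successes G (suc k) c)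
    ≡⟨ sumColorings-cong n (λ c → trans (cong ([ whiteOn S c ]·_) (successes-suc G k c))
                                          ([]·-∑ n (whiteOn S c) _)) ⟩
  sumColorings n (λ c → ∑[ v < n ] ([ whiteOn S c ]· [ c v ]· term c v))
    ≡⟨ sumColorings-∑ n n (λ c v → [ whiteOn S c ]· [ c v ]· term c v) ⟩
  ∑[ v < n ] sumColorings n (λ c → [ whiteOn S c ]· [ c v ]· term c v)
    ≡⟨ sum-cong-≗ (λ v → weight-first-vertex G S k v simple iso) ⟩
  ∑[ v < n ] ([ not (S v) ]· weight (pressGraph G v) (insert v S) k) ∎
  where
    term : Bicoloring n → Fin n → ℕ
    term c v = successes (pressGraph G v) k (c ⊕ inClosedNbhd G v)

weight-factorial : ∀ k {n} (G : Graph n) S → IsSimple G → Isolated S G → outside S ≡ k →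
  weight G S k ≡ k !
weight-factorial zero {n} G S simple iso none =
  trans (sumColorings-cong n only-white) (sumColorings-allWhite n S full)
  where
    full : ∀ x → S x ≡ true
    full = outside-zero S none
    only-white : ∀ c → ([ whiteOn S c ]· successes G 0 c) ≡ [ whiteOn S c ]· 1
    only-white c with whiteOn S c in w
    ... | false = refl
    ... | true  = successes-done G c (λ x → iso x (full x)) (λ x → whiteOn-sound S c w x (full x))
weight-factorial (suc k) {n} G S simple iso out = begin
  weight G S (suc k)                                                 ≡⟨ weight-suc G S k simple iso ⟩
  ∑[ v < n ] ([ not (S v) ]· weight (pressGraph G v) (insert v S) k) ≡⟨ sum-cong-≗ induction ⟩
  ∑[ v < n ] ([ not (S v) ]· k !)                                    ≡⟨ ∑-select n (not ∘ S) (k !) ⟩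
  outside S * k !                                                    ≡⟨ cong (_* k !) out ⟩
  suc k * k !                                                        ∎
  where
    induction : ∀ v → ([ not (S v) ]· weight (pressGraph G v) (insert v S) k) ≡ [ not (S v) ]· k !
    induction v with S v in Sv
    ... | true  = refl
    ... | false = weight-factorial k (pressGraph G v) (insert v S)
                    (pressGraph-simple G v simple) (pressGraph-isolated G S v simple iso Sv)
                    (suc-injective (trans (sym (outside-insert S v Sv)) out))

theorem3 : (n : ℕ) (G : Graph n) → IsSimple G → totalSuccessful G ≡ n !
theorem3 n G simple = begin
  totalSuccessful G
    ≡⟨ sum-bicolorings n (numSuccessful G) ⟩
  sumColorings n (numSuccessful G)
    ≡⟨ sumColorings-cong n (λ c → cong ([_]· numSuccessful G c) (sym (whiteOn-∅ c))) ⟩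
  weight G (λ _ → false) n
    ≡⟨ weight-factorial n G (λ _ → false) simple (λ _ ()) (outside-∅ n) ⟩
  n ! ∎
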